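{- Let $t\ge1$ and $0\le k,s\le\lfloor t/2\rfloor$, and let $v$ be a $k$-vector. For an $s$-vector $w$ let $(i_1,i_2,i_3,i_4)$ be its coincidence numbers with $v$, where $i_1$ (resp. $i_4$) is the number of positions in the first (resp. fourth) quarter where both $v$ and $w$ equal $1$, and $i_2$ (resp. $i_3$) is the number of positions in the second (resp. third) quarter where both equal $0$. Then $w$ is orthogonal to $v$ if and only if $i_1+i_2+i_3+i_4=2s+2k-t$. Furthermore, an $s$-vector orthogonal to $v$ exists if and only if $2s+2k-t\ge0$.
   Context: Fix $t\ge1$. A $(0,1)$-vector of length $4t$ is divided into four quarters: positions $1..t$, $t+1..2t$, $2t+1..3t$, $3t+1..4t$. For $0\le k\le t$, a $k$-vector is a $(0,1)$-vector of length $4t$ with exactly $k$, $t-k$, $t-k$, $k$ ones in the four quarters respectively. Two $(0,1)$-vectors are orthogonal if their images under $0\mapsto1$, $1\mapsto-1$ are orthogonal (standard inner product). -}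

module Defs where

open import Data.Bool using (Bool; true; false; _∧_; not)
open import Data.Nat using (ℕ; _+_)
open import Data.Vec using (Vec; take; drop; zipWith; count; foldr; map)
open import Data.Integer using (ℤ; +_; -_) renaming (_+_ to _+ℤ_; _*_ to _*ℤ_)
open import Relation.Binary.PropositionalEquality using (_≡_)
open import Data.Product using (_×_)
import Data.Bool.Properties as BP

-- A (0,1)-vector of length 4t; Bool, with true = 1 and false = 0.
BinVec : ℕ → Set
BinVec t = Vec Bool (t + t + t + t)

q₁ q₂ q₃ q₄ : (t : ℕ) → BinVec t → Vec Bool t
q₁ t v = take t (take (t + t) (take (t + t + t) v))
q₂ t v = drop t (take (t + t) (take (t + t + t) v))
q₃ t v = drop (t + t) (take (t + t + t) v)
q₄ t v = drop (t + t + t) v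

ones : {n : ℕ} → Vec Bool n → ℕ
ones = count (λ b → b BP.≟ true)

-- v is a k-vector: k, t-k, t-k, k ones in the four quarters
-- (with k ≤ t, so that t - k is a genuine subtraction)
IsKVector : (t k : ℕ) → BinVec t → Set
IsKVector t k v =
  (ones (q₁ t v) ≡ k) × (ones (q₂ t v) + k ≡ t) × (ones (q₃ t v) + k ≡ t) × (ones (q₄ t v) ≡ k)

sgn : Bool → ℤ
sgn false = + 1
sgn true  = - (+ 1)

dot : {n : ℕ} → Vec Bool n → Vec Bool n → ℤ
dot u w = foldr _ _+ℤ_ (+ 0) (zipWith (λ a b → sgn a *ℤ sgn b) u w)

Orthogonal : {n : ℕ} → Vec Bool n → Vec Bool n → Set
Orthogonal u w = dot u w ≡ + 0

bothOne bothZero : {n : ℕ} → Vec Bool n → Vec Bool n → ℕ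
bothOne  u w = ones (zipWith _∧_ u w)
bothZero u w = ones (zipWith (λ a b → not a ∧ not b) u w)

coincidenceSum : (t : ℕ) → BinVec t → BinVec t → ℕ
coincidenceSum t v w =
  bothOne (q₁ t v) (q₁ t w) + bothZero (q₂ t v) (q₂ t w) + bothZero (q₃ t v) (q₃ t w) + bothOne (q₄ t v) (q₄ t w)

module Submission where

-- Split a vector of length 4t into its four quarters.  On a single
-- block of length n the ±1 inner product of u and w equals
--     n - 2·(ones u) - 2·(ones w) + 4·(common ones),
-- and symmetrically, with zeros in place of ones.  For a k-vector v and an
-- s-vector w we use the first form on quarters 1 and 4 (where v, w have k, s ones)
-- and the second on quarters 2 and 3 (where they have k, s zeros); summing,
--     v · w = 4 (i₁ + i₂ + i₃ + i₄ - (2s + 2k - t)),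
-- which gives the orthogonality criterion.  For existence, orthogonality forces
-- 2s + 2k - t = i₁ + ⋯ + i₄ ≥ 0.  Conversely write t = k + s + r; then
-- m = 2s + 2k - t = (k + s) - r satisfies m ≤ 2·min(k, s), so m = i + j with
-- i, j ≤ min(k, s), and we build w quarter by quarter: i common ones in the first
-- quarter, j common zeros in the second, none in the other two.

open import Defs
open import Data.Bool using (Bool; true; false)
open import Data.Nat using (ℕ; zero; suc; _+_; _*_; _∸_; _≤_; _/_; _⊓_; z≤n; s≤s)
import Data.Nat.Properties as ℕP
open import Data.Nat.DivMod using (m/n*n≤m)
import Data.Nat.Tactic.RingSolver as ℕSolver
open import Data.Vec using (Vec; []; _∷_; _++_; take; drop)
open import Data.Vec.Properties using (take++drop≡id)
open import Data.Integer using (ℤ; +_; +≤+)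
  renaming (_+_ to _+ℤ_; _-_ to _-ℤ_; _*_ to _*ℤ_; _≤_ to _≤ℤ_)
import Data.Integer.Properties as ℤP
import Data.Integer.Tactic.RingSolver as ℤSolver
open import Data.Product using (_×_; ∃; _,_)
open import Data.Sum using (inj₁; inj₂)
open import Function.Bundles using (_⇔_; mk⇔; Equivalence)
open import Relation.Nullary using (yes; no)
open import Relation.Binary.PropositionalEquality
  using (_≡_; refl; sym; trans; cong; cong₂; subst; module ≡-Reasoning)

zeros : {n : ℕ} → Vec Bool n → ℕ
zeros []          = 0
zeros (true ∷ u)  = zeros u
zeros (false ∷ u) = suc (zeros u)

ones+zeros : {n : ℕ} (u : Vec Bool n) → ones u + zeros u ≡ n
ones+zeros []          = refl
ones+zeros (true ∷ u)  = cong suc (ones+zeros u)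
ones+zeros (false ∷ u) = trans (ℕP.+-suc (ones u) (zeros u)) (cong suc (ones+zeros u))

zeros-complement : {n b : ℕ} (u : Vec Bool n) → ones u + b ≡ n → zeros u ≡ b
zeros-complement u h = ℕP.+-cancelˡ-≡ (ones u) _ _ (trans (ones+zeros u) (sym h))

-- The ±1 inner product of two blocks of length n, in terms of the numbers a, b of
-- ones (or of zeros) of the two vectors and the number c of positions where they
-- agree on a one (respectively on a zero).
blockDot : ℤ → ℤ → ℤ → ℤ → ℤ
blockDot n a b c = n -ℤ (+ 2) *ℤ a -ℤ (+ 2) *ℤ b +ℤ (+ 4) *ℤ c

blockDot-cons : ∀ n a b c x y →
  ((+ 1) -ℤ (+ 2) *ℤ x) *ℤ ((+ 1) -ℤ (+ 2) *ℤ y) +ℤ blockDot n a b c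
    ≡ blockDot ((+ 1) +ℤ n) (x +ℤ a) (y +ℤ b) (x *ℤ y +ℤ c)
blockDot-cons = expanded
  where
  -- the same identity with blockDot unfolded, as the ring solver needs it
  expanded : ∀ n a b c x y →
    ((+ 1) -ℤ (+ 2) *ℤ x) *ℤ ((+ 1) -ℤ (+ 2) *ℤ y)
      +ℤ (n -ℤ (+ 2) *ℤ a -ℤ (+ 2) *ℤ b +ℤ (+ 4) *ℤ c)
      ≡ ((+ 1) +ℤ n) -ℤ (+ 2) *ℤ (x +ℤ a) -ℤ (+ 2) *ℤ (y +ℤ b) +ℤ (+ 4) *ℤ (x *ℤ y +ℤ c)
  expanded = ℤSolver.solve-∀

dot-by-ones : {n : ℕ} (u w : Vec Bool n) →
  dot u w ≡ blockDot (+ n) (+ ones u) (+ ones w) (+ bothOne u w)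
dot-by-ones []      []      = refl
dot-by-ones {suc n} (x ∷ u) (y ∷ w) =
  trans (cong (sgn x *ℤ sgn y +ℤ_) (dot-by-ones u w)) (cons x y)
  where
  cons : ∀ x y →
    sgn x *ℤ sgn y +ℤ blockDot (+ n) (+ ones u) (+ ones w) (+ bothOne u w)
      ≡ blockDot (+ suc n) (+ ones (x ∷ u)) (+ ones (y ∷ w)) (+ bothOne (x ∷ u) (y ∷ w))
  cons true  true  = blockDot-cons (+ n) (+ ones u) (+ ones w) (+ bothOne u w) (+ 1) (+ 1)
  cons true  false = blockDot-cons (+ n) (+ ones u) (+ ones w) (+ bothOne u w) (+ 1) (+ 0)
  cons false true  = blockDot-cons (+ n) (+ ones u) (+ ones w) (+ bothOne u w) (+ 0) (+ 1)
  cons false false = blockDot-cons (+ n) (+ ones u) (+ ones w) (+ bothOne u w) (+ 0) (+ 0)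

-- Inner product via common zeros: the indicator of a coordinate is 1 for `false`
-- (flipping both signs leaves each product unchanged).
dot-by-zeros : {n : ℕ} (u w : Vec Bool n) →
  dot u w ≡ blockDot (+ n) (+ zeros u) (+ zeros w) (+ bothZero u w)
dot-by-zeros []      []      = refl
dot-by-zeros {suc n} (x ∷ u) (y ∷ w) =
  trans (cong (sgn x *ℤ sgn y +ℤ_) (dot-by-zeros u w)) (cons x y)
  where
  cons : ∀ x y →
    sgn x *ℤ sgn y +ℤ blockDot (+ n) (+ zeros u) (+ zeros w) (+ bothZero u w)
      ≡ blockDot (+ suc n) (+ zeros (x ∷ u)) (+ zeros (y ∷ w)) (+ bothZero (x ∷ u) (y ∷ w))
  cons true  true  = blockDot-cons (+ n) (+ zeros u) (+ zeros w) (+ bothZero u w) (+ 0) (+ 0)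
  cons true  false = blockDot-cons (+ n) (+ zeros u) (+ zeros w) (+ bothZero u w) (+ 0) (+ 1)
  cons false true  = blockDot-cons (+ n) (+ zeros u) (+ zeros w) (+ bothZero u w) (+ 1) (+ 0)
  cons false false = blockDot-cons (+ n) (+ zeros u) (+ zeros w) (+ bothZero u w) (+ 1) (+ 1)

dot-++ : {m n : ℕ} (xs ys : Vec Bool m) (us ws : Vec Bool n) →
  dot (xs ++ us) (ys ++ ws) ≡ dot xs ys +ℤ dot us ws
dot-++ []       []       us ws = sym (ℤP.+-identityˡ (dot us ws))
dot-++ (x ∷ xs) (y ∷ ys) us ws =
  trans (cong (sgn x *ℤ sgn y +ℤ_) (dot-++ xs ys us ws))
        (sym (ℤP.+-assoc (sgn x *ℤ sgn y) (dot xs ys) (dot us ws)))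

take-++ : {A : Set} {m n : ℕ} (xs : Vec A m) (ys : Vec A n) → take m (xs ++ ys) ≡ xs
take-++ []       ys = refl
take-++ (x ∷ xs) ys = cong (x ∷_) (take-++ xs ys)

drop-++ : {A : Set} {m n : ℕ} (xs : Vec A m) (ys : Vec A n) → drop m (xs ++ ys) ≡ ys
drop-++ []       ys = refl
drop-++ (x ∷ xs) ys = drop-++ xs ys

assemble : {t : ℕ} → Vec Bool t → Vec Bool t → Vec Bool t → Vec Bool t → BinVec t
assemble w₁ w₂ w₃ w₄ = ((w₁ ++ w₂) ++ w₃) ++ w₄

assemble-quarters : (t : ℕ) (v : BinVec t) → assemble (q₁ t v) (q₂ t v) (q₃ t v) (q₄ t v) ≡ v
assemble-quarters t v = begin
  ((q₁ t v ++ q₂ t v) ++ q₃ t v) ++ q₄ t v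
    ≡⟨ cong (λ z → (z ++ q₃ t v) ++ q₄ t v) (take++drop≡id t (take (t + t) v₁₂₃)) ⟩
  (take (t + t) v₁₂₃ ++ q₃ t v) ++ q₄ t v
    ≡⟨ cong (_++ q₄ t v) (take++drop≡id (t + t) v₁₂₃) ⟩
  v₁₂₃ ++ q₄ t v
    ≡⟨ take++drop≡id (t + t + t) v ⟩
  v ∎
  where
  open ≡-Reasoning
  v₁₂₃ : Vec Bool (t + t + t)
  v₁₂₃ = take (t + t + t) v

quarters-assemble : (t : ℕ) (w₁ w₂ w₃ w₄ : Vec Bool t) → let w = assemble w₁ w₂ w₃ w₄ in
  (q₁ t w ≡ w₁) × (q₂ t w ≡ w₂) × (q₃ t w ≡ w₃) × (q₄ t w ≡ w₄)
quarters-assemble t w₁ w₂ w₃ w₄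
  rewrite take-++ ((w₁ ++ w₂) ++ w₃) w₄ | take-++ (w₁ ++ w₂) w₃ | take-++ w₁ w₂
        | drop-++ w₁ w₂ | drop-++ (w₁ ++ w₂) w₃ | drop-++ ((w₁ ++ w₂) ++ w₃) w₄
  = refl , refl , refl , refl

dot-quarters : (t : ℕ) (v w : BinVec t) →
  dot v w ≡ dot (q₁ t v) (q₁ t w) +ℤ dot (q₂ t v) (q₂ t w)
            +ℤ dot (q₃ t v) (q₃ t w) +ℤ dot (q₄ t v) (q₄ t w)
dot-quarters t v w = begin
  dot v w
    ≡⟨ sym (cong₂ dot (assemble-quarters t v) (assemble-quarters t w)) ⟩
  dot (((v₁ ++ v₂) ++ v₃) ++ v₄) (((w₁ ++ w₂) ++ w₃) ++ w₄)
    ≡⟨ dot-++ ((v₁ ++ v₂) ++ v₃) ((w₁ ++ w₂) ++ w₃) v₄ w₄ ⟩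
  dot ((v₁ ++ v₂) ++ v₃) ((w₁ ++ w₂) ++ w₃) +ℤ dot v₄ w₄
    ≡⟨ cong (_+ℤ dot v₄ w₄) (dot-++ (v₁ ++ v₂) (w₁ ++ w₂) v₃ w₃) ⟩
  dot (v₁ ++ v₂) (w₁ ++ w₂) +ℤ dot v₃ w₃ +ℤ dot v₄ w₄
    ≡⟨ cong (λ z → z +ℤ dot v₃ w₃ +ℤ dot v₄ w₄) (dot-++ v₁ w₁ v₂ w₂) ⟩
  dot v₁ w₁ +ℤ dot v₂ w₂ +ℤ dot v₃ w₃ +ℤ dot v₄ w₄
    ∎
  where
  open ≡-Reasoning
  v₁ v₂ v₃ v₄ w₁ w₂ w₃ w₄ : Vec Bool t
  v₁ = q₁ t v; v₂ = q₂ t v; v₃ = q₃ t v; v₄ = q₄ t v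
  w₁ = q₁ t w; w₂ = q₂ t w; w₃ = q₃ t w; w₄ = q₄ t w

dot-ones-block : {n a b : ℕ} (u w : Vec Bool n) → ones u ≡ a → ones w ≡ b →
  dot u w ≡ blockDot (+ n) (+ a) (+ b) (+ bothOne u w)
dot-ones-block u w refl refl = dot-by-ones u w

dot-zeros-block : {n a b : ℕ} (u w : Vec Bool n) → ones u + a ≡ n → ones w + b ≡ n →
  dot u w ≡ blockDot (+ n) (+ a) (+ b) (+ bothZero u w)
dot-zeros-block u w hu hw =
  trans (dot-by-zeros u w)
        (cong₂ (λ a b → blockDot (+ _) (+ a) (+ b) (+ bothZero u w))
               (zeros-complement u hu) (zeros-complement w hw))

target : ℕ → ℕ → ℕ → ℤ
target t k s = (+ 2) *ℤ (+ s) +ℤ (+ 2) *ℤ (+ k) -ℤ (+ t)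

four-blocks : ∀ n a b c₁ c₂ c₃ c₄ →
  blockDot n a b c₁ +ℤ blockDot n a b c₂ +ℤ blockDot n a b c₃ +ℤ blockDot n a b c₄
    ≡ (+ 4) *ℤ ((c₁ +ℤ c₂ +ℤ c₃ +ℤ c₄) -ℤ ((+ 2) *ℤ b +ℤ (+ 2) *ℤ a -ℤ n))
four-blocks = expanded
  where
  -- the same identity with blockDot unfolded, as the ring solver needs it
  expanded : ∀ n a b c₁ c₂ c₃ c₄ →
    (n -ℤ (+ 2) *ℤ a -ℤ (+ 2) *ℤ b +ℤ (+ 4) *ℤ c₁)
      +ℤ (n -ℤ (+ 2) *ℤ a -ℤ (+ 2) *ℤ b +ℤ (+ 4) *ℤ c₂)
      +ℤ (n -ℤ (+ 2) *ℤ a -ℤ (+ 2) *ℤ b +ℤ (+ 4) *ℤ c₃)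
      +ℤ (n -ℤ (+ 2) *ℤ a -ℤ (+ 2) *ℤ b +ℤ (+ 4) *ℤ c₄)
      ≡ (+ 4) *ℤ ((c₁ +ℤ c₂ +ℤ c₃ +ℤ c₄) -ℤ ((+ 2) *ℤ b +ℤ (+ 2) *ℤ a -ℤ n))
  expanded = ℤSolver.solve-∀

dot-kvectors : {t k s : ℕ} (v w : BinVec t) → IsKVector t k v → IsKVector t s w →
  dot v w ≡ (+ 4) *ℤ (+ coincidenceSum t v w -ℤ target t k s)
dot-kvectors {t} {k} {s} v w (v₁ , v₂ , v₃ , v₄) (w₁ , w₂ , w₃ , w₄) = begin
  dot v w
    ≡⟨ dot-quarters t v w ⟩
  dot (q₁ t v) (q₁ t w) +ℤ dot (q₂ t v) (q₂ t w) +ℤ dot (q₃ t v) (q₃ t w) +ℤ dot (q₄ t v) (q₄ t w)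
    ≡⟨ cong₂ _+ℤ_ (cong₂ _+ℤ_ (cong₂ _+ℤ_ (dot-ones-block (q₁ t v) (q₁ t w) v₁ w₁)
                                          (dot-zeros-block (q₂ t v) (q₂ t w) v₂ w₂))
                                (dot-zeros-block (q₃ t v) (q₃ t w) v₃ w₃))
                  (dot-ones-block (q₄ t v) (q₄ t w) v₄ w₄) ⟩
  blockDot T K S (+ i₁) +ℤ blockDot T K S (+ i₂) +ℤ blockDot T K S (+ i₃) +ℤ blockDot T K S (+ i₄)
    ≡⟨ four-blocks T K S (+ i₁) (+ i₂) (+ i₃) (+ i₄) ⟩
  (+ 4) *ℤ (+ coincidenceSum t v w -ℤ target t k s)
    ∎
  where
  open ≡-Reasoning
  T K S : ℤ
  T = + t; K = + k; S = + s
  i₁ i₂ i₃ i₄ : ℕ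
  i₁ = bothOne (q₁ t v) (q₁ t w)
  i₂ = bothZero (q₂ t v) (q₂ t w)
  i₃ = bothZero (q₃ t v) (q₃ t w)
  i₄ = bothOne (q₄ t v) (q₄ t w)

four-times-difference : (x y : ℤ) → ((+ 4) *ℤ (x -ℤ y) ≡ + 0) ⇔ (x ≡ y)
four-times-difference x y = mk⇔ to from
  where
  to : (+ 4) *ℤ (x -ℤ y) ≡ + 0 → x ≡ y
  to h with ℤP.i*j≡0⇒i≡0∨j≡0 (+ 4) h
  ... | inj₁ ()
  ... | inj₂ x-y≡0 = ℤP.i-j≡0⇒i≡j x y x-y≡0
  from : x ≡ y → (+ 4) *ℤ (x -ℤ y) ≡ + 0
  from refl = trans (cong ((+ 4) *ℤ_) (ℤP.+-inverseʳ x)) (ℤP.*-zeroʳ (+ 4))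

orthogonal⇔coincidence : {t k s : ℕ} (v w : BinVec t) → IsKVector t k v → IsKVector t s w →
  Orthogonal v w ⇔ (+ coincidenceSum t v w ≡ target t k s)
orthogonal⇔coincidence {t} {k} {s} v w hv hw =
  subst (λ d → (d ≡ + 0) ⇔ (+ coincidenceSum t v w ≡ target t k s))
        (sym (dot-kvectors v w hv hw))
        (four-times-difference (+ coincidenceSum t v w) (target t k s))

-- Necessity: orthogonality makes 2s + 2k - t a coincidence count, hence nonnegative.
orthogonal⇒target-nonneg : {t k s : ℕ} (v w : BinVec t) → IsKVector t k v → IsKVector t s w →
  Orthogonal v w → + 0 ≤ℤ target t k s
orthogonal⇒target-nonneg v w hv hw o =
  subst (+ 0 ≤ℤ_) (Equivalence.to (orthogonal⇔coincidence v w hv hw) o) (+≤+ z≤n)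

prescribe : {n : ℕ} (u : Vec Bool n) (p q : ℕ) → p ≤ ones u → q ≤ zeros u →
  ∃ λ w → (bothOne u w ≡ p) × (bothZero u w ≡ q) × (ones w + q ≡ p + zeros u)
prescribe []          zero    zero    z≤n       z≤n = [] , refl , refl , refl
prescribe (true ∷ u)  (suc p) q       (s≤s p≤) q≤
  with w , one≡ , zero≡ , ones≡ ← prescribe u p q p≤ q≤
  = true ∷ w , cong suc one≡ , zero≡ , cong suc ones≡
prescribe (true ∷ u)  zero    q       _         q≤
  with w , one≡ , zero≡ , ones≡ ← prescribe u zero q z≤n q≤
  = false ∷ w , one≡ , zero≡ , ones≡
prescribe (false ∷ u) p       (suc q) p≤        (s≤s q≤)
  with w , one≡ , zero≡ , ones≡ ← prescribe u p q p≤ q≤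
  = false ∷ w , one≡ , cong suc zero≡
  , trans (ℕP.+-suc (ones w) q) (trans (cong suc ones≡) (sym (ℕP.+-suc p (zeros u))))
prescribe (false ∷ u) p       zero    p≤        _
  with w , one≡ , zero≡ , ones≡ ← prescribe u p zero p≤ z≤n
  = true ∷ w , one≡ , zero≡ , trans (cong suc ones≡) (sym (ℕP.+-suc p (zeros u)))

quarter-common-ones : (k s r i : ℕ) (u : Vec Bool (k + s + r)) →
  ones u ≡ k → i ≤ k → i ≤ s → ∃ λ w → (bothOne u w ≡ i) × (ones w ≡ s)
quarter-common-ones k s r i u ones≡k i≤k i≤s =
  adjust (prescribe u i (r + i) (subst (i ≤_) (sym ones≡k) i≤k) r+i≤zeros)
  where
  zeros≡ : zeros u ≡ s + r
  zeros≡ = zeros-complement u (trans (cong (_+ (s + r)) ones≡k) (sym (ℕP.+-assoc k s r)))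
  r+i≤zeros : r + i ≤ zeros u
  r+i≤zeros = subst (r + i ≤_) (trans (ℕP.+-comm r s) (sym zeros≡)) (ℕP.+-monoʳ-≤ r i≤s)
  shuffle : ∀ i s r → i + (s + r) ≡ s + (r + i)
  shuffle = ℕSolver.solve-∀
  adjust : (∃ λ w → (bothOne u w ≡ i) × (bothZero u w ≡ r + i) × (ones w + (r + i) ≡ i + zeros u)) →
           ∃ λ w → (bothOne u w ≡ i) × (ones w ≡ s)
  adjust (w , one≡ , _ , ones≡) =
    w , one≡ , ℕP.+-cancelʳ-≡ (r + i) (ones w) s
                 (trans ones≡ (trans (cong (λ z → i + z) zeros≡) (shuffle i s r)))

quarter-common-zeros : (k s r i : ℕ) (u : Vec Bool (k + s + r)) →
  ones u + k ≡ k + s + r → i ≤ k → i ≤ s →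
  ∃ λ w → (bothZero u w ≡ i) × (ones w + s ≡ k + s + r)
quarter-common-zeros k s r i u ones+k≡ i≤k i≤s =
  adjust (prescribe u (r + i) i r+i≤ones (subst (i ≤_) (sym zeros≡) i≤k))
  where
  zeros≡ : zeros u ≡ k
  zeros≡ = zeros-complement u ones+k≡
  ones≡ : ones u ≡ s + r
  ones≡ = ℕP.+-cancelʳ-≡ k (ones u) (s + r)
            (trans ones+k≡ (trans (ℕP.+-assoc k s r) (ℕP.+-comm k (s + r))))
  r+i≤ones : r + i ≤ ones u
  r+i≤ones = subst (r + i ≤_) (trans (ℕP.+-comm r s) (sym ones≡)) (ℕP.+-monoʳ-≤ r i≤s)
  shuffle₁ : ∀ r i k → r + i + k ≡ r + k + i
  shuffle₁ = ℕSolver.solve-∀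
  shuffle₂ : ∀ r k s → r + k + s ≡ k + s + r
  shuffle₂ = ℕSolver.solve-∀
  adjust : (∃ λ w → (bothOne u w ≡ r + i) × (bothZero u w ≡ i) × (ones w + i ≡ r + i + zeros u)) →
           ∃ λ w → (bothZero u w ≡ i) × (ones w + s ≡ k + s + r)
  adjust (w , _ , zero≡ , ones+i≡) = w , zero≡ , trans (cong (_+ s) ones≡r+k) (shuffle₂ r k s)
    where
    ones≡r+k : ones w ≡ r + k
    ones≡r+k = ℕP.+-cancelʳ-≡ i (ones w) (r + k)
                 (trans ones+i≡ (trans (cong (λ z → r + i + z) zeros≡) (shuffle₁ r i k)))

IsKVector-assemble : {t s : ℕ} (w₁ w₂ w₃ w₄ : Vec Bool t) →
  ones w₁ ≡ s → ones w₂ + s ≡ t → ones w₃ + s ≡ t → ones w₄ ≡ s →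
  IsKVector t s (assemble w₁ w₂ w₃ w₄)
IsKVector-assemble {t} w₁ w₂ w₃ w₄ o₁ o₂ o₃ o₄
  with p₁ , p₂ , p₃ , p₄ ← quarters-assemble t w₁ w₂ w₃ w₄
  rewrite p₁ | p₂ | p₃ | p₄ = o₁ , o₂ , o₃ , o₄

coincidenceSum-assemble : (t : ℕ) (v : BinVec t) (w₁ w₂ w₃ w₄ : Vec Bool t) →
  coincidenceSum t v (assemble w₁ w₂ w₃ w₄)
    ≡ bothOne (q₁ t v) w₁ + bothZero (q₂ t v) w₂ + bothZero (q₃ t v) w₃ + bothOne (q₄ t v) w₄
coincidenceSum-assemble t v w₁ w₂ w₃ w₄
  with p₁ , p₂ , p₃ , p₄ ← quarters-assemble t w₁ w₂ w₃ w₄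
  rewrite p₁ | p₂ | p₃ | p₄ = refl

s-vector-with-coincidences : (k s r i j : ℕ) (v : BinVec (k + s + r)) →
  IsKVector (k + s + r) k v → i ≤ k → i ≤ s → j ≤ k → j ≤ s →
  ∃ λ w → IsKVector (k + s + r) s w × (coincidenceSum (k + s + r) v w ≡ i + j)
s-vector-with-coincidences k s r i j v (v₁ , v₂ , v₃ , v₄) i≤k i≤s j≤k j≤s
  with w₁ , c₁ , o₁ ← quarter-common-ones  k s r i (q₁ (k + s + r) v) v₁ i≤k i≤s
     | w₂ , c₂ , o₂ ← quarter-common-zeros k s r j (q₂ (k + s + r) v) v₂ j≤k j≤s
     | w₃ , c₃ , o₃ ← quarter-common-zeros k s r 0 (q₃ (k + s + r) v) v₃ z≤n z≤n
     | w₄ , c₄ , o₄ ← quarter-common-ones  k s r 0 (q₄ (k + s + r) v) v₄ z≤n z≤n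
  = assemble w₁ w₂ w₃ w₄
  , IsKVector-assemble w₁ w₂ w₃ w₄ o₁ o₂ o₃ o₄
  , trans (coincidenceSum-assemble (k + s + r) v w₁ w₂ w₃ w₄) (sum≡ c₁ c₂ c₃ c₄)
  where
  sum≡ : ∀ {a b c d} → a ≡ i → b ≡ j → c ≡ 0 → d ≡ 0 → a + b + c + d ≡ i + j
  sum≡ refl refl refl refl = trans (ℕP.+-identityʳ (i + j + 0)) (ℕP.+-identityʳ (i + j))

double≤ : {t k : ℕ} → k ≤ t / 2 → k + k ≤ t
double≤ {t} {k} k≤t/2 =
  subst (_≤ t) (k*2≡k+k k) (ℕP.≤-trans (ℕP.*-monoˡ-≤ 2 k≤t/2) (m/n*n≤m t 2))
  where
  k*2≡k+k : ∀ k → k * 2 ≡ k + k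
  k*2≡k+k = ℕSolver.solve-∀

sum≤ : {a b t : ℕ} → a + a ≤ t → b + b ≤ t → a + b ≤ t
sum≤ {a} {b} 2a≤t 2b≤t with ℕP.≤-total a b
... | inj₁ a≤b = ℕP.≤-trans (ℕP.+-monoˡ-≤ b a≤b) 2b≤t
... | inj₂ b≤a = ℕP.≤-trans (ℕP.+-monoʳ-≤ a b≤a) 2a≤t

target-split : (k s r : ℕ) → target (k + s + r) k s ≡ + (k + s) -ℤ + r
target-split k s r = identity (+ k) (+ s) (+ r)
  where
  identity : ∀ K S R → (+ 2) *ℤ S +ℤ (+ 2) *ℤ K -ℤ (K +ℤ S +ℤ R) ≡ (K +ℤ S) -ℤ R
  identity = ℤSolver.solve-∀

target-excess : (k s r m : ℕ) → r + m ≡ k + s → target (k + s + r) k s ≡ + m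
target-excess k s r m r+m≡k+s = begin
  target (k + s + r) k s ≡⟨ target-split k s r ⟩
  + (k + s) -ℤ + r       ≡⟨ cong (λ x → + x -ℤ + r) (sym r+m≡k+s) ⟩
  (+ r +ℤ + m) -ℤ + r    ≡⟨ identity (+ r) (+ m) ⟩
  + m                    ∎
  where
  open ≡-Reasoning
  identity : ∀ R M → (R +ℤ M) -ℤ R ≡ M
  identity = ℤSolver.solve-∀

excess≤double : (a b r m : ℕ) → r + m ≡ a + b → b + b ≤ a + b + r → m ≤ a + a
excess≤double a b r m r+m≡a+b 2b≤ = ℕP.+-cancelˡ-≤ r m (a + a) (begin
  r + m       ≡⟨ r+m≡a+b ⟩
  a + b       ≤⟨ ℕP.+-monoʳ-≤ a b≤a+r ⟩
  a + (a + r) ≡⟨ shuffle₂ a r ⟩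
  r + (a + a) ∎)
  where
  open ℕP.≤-Reasoning
  shuffle₁ : ∀ a b r → a + b + r ≡ a + r + b
  shuffle₁ = ℕSolver.solve-∀
  shuffle₂ : ∀ a r → a + (a + r) ≡ r + (a + a)
  shuffle₂ = ℕSolver.solve-∀
  b≤a+r : b ≤ a + r
  b≤a+r = ℕP.+-cancelʳ-≤ b b (a + r) (subst (b + b ≤_) (shuffle₁ a b r) 2b≤)

≤-double-min : {m : ℕ} (a b : ℕ) → m ≤ a + a → m ≤ b + b → m ≤ a ⊓ b + a ⊓ b
≤-double-min {m} a b m≤2a m≤2b with ℕP.⊓-sel a b
... | inj₁ min≡a = subst (λ c → m ≤ c + c) (sym min≡a) m≤2a
... | inj₂ min≡b = subst (λ c → m ≤ c + c) (sym min≡b) m≤2b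

halve : (m c : ℕ) → m ≤ c + c → ∃ λ i → ∃ λ j → (i ≤ c) × (j ≤ c) × (i + j ≡ m)
halve m c m≤2c with m ℕP.≤? c
... | yes m≤c = m , 0 , m≤c , z≤n , ℕP.+-identityʳ m
... | no  m≰c =
  c , m ∸ c , ℕP.≤-refl , ℕP.m≤n+o⇒m∸n≤o m c m≤2c , ℕP.m+[n∸m]≡n (ℕP.≰⇒≥ m≰c)

split-bounded : (m a b : ℕ) → m ≤ a + a → m ≤ b + b →
  ∃ λ i → ∃ λ j → (i ≤ a) × (i ≤ b) × (j ≤ a) × (j ≤ b) × (i + j ≡ m)
split-bounded m a b m≤2a m≤2b
  with i , j , i≤ , j≤ , i+j≡m ← halve m (a ⊓ b) (≤-double-min a b m≤2a m≤2b)
  = i , j , ℕP.≤-trans i≤ (ℕP.m⊓n≤m a b) , ℕP.≤-trans i≤ (ℕP.m⊓n≤n a b)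
          , ℕP.≤-trans j≤ (ℕP.m⊓n≤m a b) , ℕP.≤-trans j≤ (ℕP.m⊓n≤n a b) , i+j≡m

target-split-bounded : (k s r : ℕ) → k + k ≤ k + s + r → s + s ≤ k + s + r →
  + 0 ≤ℤ target (k + s + r) k s →
  ∃ λ i → ∃ λ j → (i ≤ k) × (i ≤ s) × (j ≤ k) × (j ≤ s) × (target (k + s + r) k s ≡ + (i + j))
target-split-bounded k s r 2k≤t 2s≤t 0≤target = split (ℕP.m≤n⇒∃[o]m+o≡n r≤k+s)
  where
  r≤k+s : r ≤ k + s
  r≤k+s = ℤP.drop‿+≤+ (ℤP.0≤i-j⇒j≤i (subst (+ 0 ≤ℤ_) (target-split k s r) 0≤target))
  2k≤s+k+r : k + k ≤ s + k + r
  2k≤s+k+r = subst (k + k ≤_) (cong (_+ r) (ℕP.+-comm k s)) 2k≤t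
  split : (∃ λ m → r + m ≡ k + s) →
    ∃ λ i → ∃ λ j → (i ≤ k) × (i ≤ s) × (j ≤ k) × (j ≤ s) × (target (k + s + r) k s ≡ + (i + j))
  split (m , r+m≡k+s)
    with i , j , i≤k , i≤s , j≤k , j≤s , i+j≡m
           ← split-bounded m k s (excess≤double k s r m r+m≡k+s 2s≤t)
                                 (excess≤double s k r m (trans r+m≡k+s (ℕP.+-comm k s)) 2k≤s+k+r)
    = i , j , i≤k , i≤s , j≤k , j≤s , trans (target-excess k s r m r+m≡k+s) (cong +_ (sym i+j≡m))

orthogonal-s-vector′ : (k s r : ℕ) → k + k ≤ k + s + r → s + s ≤ k + s + r →
  + 0 ≤ℤ target (k + s + r) k s → (v : BinVec (k + s + r)) → IsKVector (k + s + r) k v →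
  ∃ λ w → IsKVector (k + s + r) s w × Orthogonal v w
orthogonal-s-vector′ k s r 2k≤t 2s≤t 0≤target v hv =
  let i , j , i≤k , i≤s , j≤k , j≤s , target≡ = target-split-bounded k s r 2k≤t 2s≤t 0≤target
      w , hw , coincidences = s-vector-with-coincidences k s r i j v hv i≤k i≤s j≤k j≤s
  in w , hw , Equivalence.from (orthogonal⇔coincidence v w hv hw)
                               (trans (cong +_ coincidences) (sym target≡))

orthogonal-s-vector : (t k s : ℕ) → k + k ≤ t → s + s ≤ t → + 0 ≤ℤ target t k s →
  (v : BinVec t) → IsKVector t k v → ∃ λ w → IsKVector t s w × Orthogonal v w
orthogonal-s-vector t k s 2k≤t 2s≤t
  with r , refl ← ℕP.m≤n⇒∃[o]m+o≡n {k + s} (sum≤ {k} {s} 2k≤t 2s≤t)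
  = orthogonal-s-vector′ k s r 2k≤t 2s≤t

proposition5 : (t k s : ℕ) → 1 ≤ t → k ≤ t / 2 → s ≤ t / 2 → (v : BinVec t) → IsKVector t k v
    → ((w : BinVec t) → IsKVector t s w
        → (Orthogonal v w ⇔ (+ coincidenceSum t v w ≡ (+ 2) *ℤ (+ s) +ℤ (+ 2) *ℤ (+ k) -ℤ (+ t))))
      × ((∃ λ (w : BinVec t) → IsKVector t s w × Orthogonal v w)
          ⇔ (+ 0 ≤ℤ (+ 2) *ℤ (+ s) +ℤ (+ 2) *ℤ (+ k) -ℤ (+ t)))
proposition5 t k s _ k≤t/2 s≤t/2 v hv =
    (λ w hw → orthogonal⇔coincidence v w hv hw)
  , mk⇔ (λ (w , hw , o) → orthogonal⇒target-nonneg v w hv hw o)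
        (λ 0≤target → orthogonal-s-vector t k s (double≤ k≤t/2) (double≤ s≤t/2) 0≤target v hv)
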